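{- For all integers $0\le u\le v$ (with $v\ge1$, or $u=v=0$) and integers $x_1,\dots,x_v$, $$g_{u,v}(q^{ -1};2-x_1,\dots,2-x_v)=q^{ -u(2v+u-1)}\,g_{u,v}(q;x_1,\dots,x_v).$$
   Context: $g_{0,0}=1$, and for $u\le v$, $$g_{u,v}(q;x_1,\dots,x_v)=\sum_{\substack{\epsilon_1,\dots,\epsilon_v\in\{0,1\}\\ \epsilon_1+\dots+\epsilon_v=u}}q^{uv+\binom{u}{2}}\prod_{k=1}^v q^{(x_k-1)\sum_{i=1}^{k-1}\epsilon_i}.$$ -}

module Defs where

open import Level using (Level)
open import Algebra.Bundles using (CommutativeRing)
open import Data.Bool using (Bool; true; false)
open import Data.Nat as ℕ using (ℕ; zero; suc)
open import Data.Nat.Combinatorics using (_C_)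
open import Data.Integer as ℤ using (ℤ; +_; -[1+_])
open import Data.Vec using (Vec; []; _∷_)
open import Data.List using (List; []; _∷_; map; filterᵇ; _++_)

-- All 0/1-vectors (ε₁,…,εₙ) of length n, encoded as Vec Bool n (true = 1).
allBoolVecs : (n : ℕ) → List (Vec Bool n)
allBoolVecs zero = [] ∷ []
allBoolVecs (suc n) = map (false ∷_) (allBoolVecs n) ++ map (true ∷_) (allBoolVecs n)

bit : Bool → ℕ
bit true = 1
bit false = 0

weight : ∀ {n} → Vec Bool n → ℕ
weight [] = 0
weight (e ∷ es) = bit e ℕ.+ weight es

prefExp : ∀ {n} → ℕ → Vec ℤ n → Vec Bool n → ℤ
prefExp c [] [] = + 0
prefExp c (x ∷ xs) (e ∷ es) = (x ℤ.- + 1) ℤ.* (+ c) ℤ.+ prefExp (c ℕ.+ bit e) xs es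

-- Exponent of q in the summand indexed by ε:
-- uv + binom(u,2) + Σ_{k=1}^{v} (x_k - 1) Σ_{i=1}^{k-1} ε_i
gExp : (u v : ℕ) → Vec ℤ v → Vec Bool v → ℤ
gExp u v x ε = + (u ℕ.* v ℕ.+ (u C 2)) ℤ.+ prefExp 0 x ε

module _ {c ℓ : Level} (R : CommutativeRing c ℓ) where
  open CommutativeRing R

  -- Integer power of q, where qi plays the role of q⁻¹.
  pow : Carrier → ℕ → Carrier
  pow a zero = 1#
  pow a (suc n) = a * pow a n

  zpow : Carrier → Carrier → ℤ → Carrier
  zpow q qi (+ n) = pow q n
  zpow q qi -[1+ n ] = pow qi (suc n)

  sumR : List Carrier → Carrier
  sumR [] = 0#
  sumR (a ∷ as) = a + sumR as

  -- g_{u,v}(q; x₁,…,x_v), evaluated at a unit q with inverse qi.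
  -- (g_{0,0} = 1 is the case v = 0: the single empty ε, exponent 0.)
  g : (q qi : Carrier) (u v : ℕ) → Vec ℤ v → Carrier
  g q qi u v x =
    sumR (map (λ ε → zpow q qi (gExp u v x ε))
              (filterᵇ (λ ε → weight ε ℕ.≡ᵇ u) (allBoolVecs v)))

-- The exponent of the summand indexed by ε is
-- A + P(x, ε), with A = uv + C(u,2) and P linear in the x_k - 1. Replacing x_k by 2 - x_k
-- negates P, and replacing q by q⁻¹ negates the whole exponent, so the new summand is
-- q^(-(A - P)) = q^(-2A) · q^(A + P), where 2A = u(2v + u - 1).
module Submission where

open import Defs
open import Level using (Level)
open import Algebra.Bundles using (CommutativeRing)
open import Data.Nat as ℕ using (ℕ)
open import Data.Integer as ℤ using (ℤ; +_)
open import Data.Vec using (Vec; map; []; _∷_)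
open import Function using (_∘_)

open import Data.Bool using (Bool)
open import Data.List as List using (List)
open import Data.Nat.Combinatorics using (_C_; nC1≡n; nCk+nC[k+1]≡[n+1]C[k+1])
import Data.Nat.Properties as ℕ
import Data.Integer.Properties as ℤ
import Data.Nat.Tactic.RingSolver as ℕ-Solver
import Data.Integer.Tactic.RingSolver as ℤ-Solver
open import Relation.Binary.PropositionalEquality as ≡ using (_≡_; refl; module ≡-Reasoning)
import Relation.Binary.Reasoning.Setoid as SetoidReasoning
import Algebra.Properties.CommutativeSemigroup as CommutativeSemigroupProperties

[1+n]C2≡n+nC2 : ∀ n → ℕ.suc n C 2 ≡ n ℕ.+ n C 2
[1+n]C2≡n+nC2 n =
  ≡.trans (≡.sym (nCk+nC[k+1]≡[n+1]C[k+1] n 1)) (≡.cong (ℕ._+ n C 2) (nC1≡n n))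

2*[1+n]C2≡[1+n]*n : ∀ n → 2 ℕ.* (ℕ.suc n C 2) ≡ ℕ.suc n ℕ.* n
2*[1+n]C2≡[1+n]*n ℕ.zero = refl
2*[1+n]C2≡[1+n]*n (ℕ.suc n) = begin
  2 ℕ.* (ℕ.suc (ℕ.suc n) C 2)            ≡⟨ ≡.cong (2 ℕ.*_) ([1+n]C2≡n+nC2 (ℕ.suc n)) ⟩
  2 ℕ.* (ℕ.suc n ℕ.+ ℕ.suc n C 2)         ≡⟨ ℕ.*-distribˡ-+ 2 (ℕ.suc n) _ ⟩
  2 ℕ.* ℕ.suc n ℕ.+ 2 ℕ.* (ℕ.suc n C 2)   ≡⟨ ≡.cong (2 ℕ.* ℕ.suc n ℕ.+_) (2*[1+n]C2≡[1+n]*n n) ⟩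
  2 ℕ.* ℕ.suc n ℕ.+ ℕ.suc n ℕ.* n         ≡⟨ expand n ⟩
  ℕ.suc (ℕ.suc n) ℕ.* ℕ.suc n             ∎
  where
  open ≡-Reasoning
  expand : ∀ m → 2 ℕ.* ℕ.suc m ℕ.+ ℕ.suc m ℕ.* m ≡ ℕ.suc (ℕ.suc m) ℕ.* ℕ.suc m
  expand = ℕ-Solver.solve-∀

u*[2v+u∸1]≡2*[uv+uC2] : ∀ u v → u ℕ.* (2 ℕ.* v ℕ.+ u ℕ.∸ 1) ≡ 2 ℕ.* (u ℕ.* v ℕ.+ u C 2)
u*[2v+u∸1]≡2*[uv+uC2] ℕ.zero v = refl
u*[2v+u∸1]≡2*[uv+uC2] (ℕ.suc w) v = begin
  ℕ.suc w ℕ.* (2 ℕ.* v ℕ.+ ℕ.suc w ℕ.∸ 1)            ≡⟨ ≡.cong (λ t → ℕ.suc w ℕ.* (t ℕ.∸ 1)) (ℕ.+-suc (2 ℕ.* v) w) ⟩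
  ℕ.suc w ℕ.* (2 ℕ.* v ℕ.+ w)                        ≡⟨ expand w v ⟩
  2 ℕ.* (ℕ.suc w ℕ.* v) ℕ.+ ℕ.suc w ℕ.* w            ≡⟨ ≡.cong (2 ℕ.* (ℕ.suc w ℕ.* v) ℕ.+_) (≡.sym (2*[1+n]C2≡[1+n]*n w)) ⟩
  2 ℕ.* (ℕ.suc w ℕ.* v) ℕ.+ 2 ℕ.* (ℕ.suc w C 2)      ≡⟨ ≡.sym (ℕ.*-distribˡ-+ 2 (ℕ.suc w ℕ.* v) _) ⟩
  2 ℕ.* (ℕ.suc w ℕ.* v ℕ.+ ℕ.suc w C 2)              ∎
  where
  open ≡-Reasoning
  expand : ∀ m n → ℕ.suc m ℕ.* (2 ℕ.* n ℕ.+ m) ≡ 2 ℕ.* (ℕ.suc m ℕ.* n) ℕ.+ ℕ.suc m ℕ.* m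
  expand = ℕ-Solver.solve-∀

prefExp-reflect : ∀ {n} c (x : Vec ℤ n) (ε : Vec Bool n) →
  prefExp c (map (λ xk → + 2 ℤ.- xk) x) ε ≡ ℤ.- prefExp c x ε
prefExp-reflect c [] [] = refl
prefExp-reflect c (xk ∷ x) (e ∷ ε) = begin
  (+ 2 ℤ.- xk ℤ.- + 1) ℤ.* + c ℤ.+ prefExp c′ (map (λ xk → + 2 ℤ.- xk) x) ε
    ≡⟨ ≡.cong₂ ℤ._+_ (reflect-term xk (+ c)) (prefExp-reflect c′ x ε) ⟩
  ℤ.- ((xk ℤ.- + 1) ℤ.* + c) ℤ.+ ℤ.- prefExp c′ x ε
    ≡⟨ ≡.sym (ℤ.neg-distrib-+ ((xk ℤ.- + 1) ℤ.* + c) (prefExp c′ x ε)) ⟩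
  ℤ.- ((xk ℤ.- + 1) ℤ.* + c ℤ.+ prefExp c′ x ε) ∎
  where
  open ≡-Reasoning
  c′ = c ℕ.+ bit e
  reflect-term : ∀ y d → (+ 2 ℤ.- y ℤ.- + 1) ℤ.* d ≡ ℤ.- ((y ℤ.- + 1) ℤ.* d)
  reflect-term = ℤ-Solver.solve-∀

gExp-reflect : ∀ u v (x : Vec ℤ v) ε →
  ℤ.- gExp u v (map (λ xk → + 2 ℤ.- xk) x) ε
    ≡ ℤ.- (+ (u ℕ.* (2 ℕ.* v ℕ.+ u ℕ.∸ 1))) ℤ.+ gExp u v x ε
gExp-reflect u v x ε = begin
  ℤ.- (+ A ℤ.+ prefExp 0 (map (λ xk → + 2 ℤ.- xk) x) ε)
    ≡⟨ ≡.cong (λ p → ℤ.- (+ A ℤ.+ p)) (prefExp-reflect 0 x ε) ⟩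
  ℤ.- (+ A ℤ.+ ℤ.- P)
    ≡⟨ negate-difference (+ A) P ⟩
  ℤ.- (+ 2 ℤ.* + A) ℤ.+ (+ A ℤ.+ P)
    ≡⟨ ≡.cong (λ n → ℤ.- n ℤ.+ (+ A ℤ.+ P)) (≡.sym (ℤ.pos-* 2 A)) ⟩
  ℤ.- (+ (2 ℕ.* A)) ℤ.+ (+ A ℤ.+ P)
    ≡⟨ ≡.cong (λ n → ℤ.- (+ n) ℤ.+ (+ A ℤ.+ P)) (≡.sym (u*[2v+u∸1]≡2*[uv+uC2] u v)) ⟩
  ℤ.- (+ (u ℕ.* (2 ℕ.* v ℕ.+ u ℕ.∸ 1))) ℤ.+ (+ A ℤ.+ P) ∎
  where
  open ≡-Reasoning
  A = u ℕ.* v ℕ.+ u C 2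
  P = prefExp 0 x ε
  negate-difference : ∀ a p → ℤ.- (a ℤ.+ ℤ.- p) ≡ ℤ.- (+ 2 ℤ.* a) ℤ.+ (a ℤ.+ p)
  negate-difference = ℤ-Solver.solve-∀

module _ {c ℓ : Level} (R : CommutativeRing c ℓ) where
  open CommutativeRing R
  open CommutativeSemigroupProperties *-commutativeSemigroup using (interchange)

  pow-+ : ∀ a m n → pow R a (m ℕ.+ n) ≈ pow R a m * pow R a n
  pow-+ a ℕ.zero    n = sym (*-identityˡ _)
  pow-+ a (ℕ.suc m) n = trans (*-congˡ (pow-+ a m n)) (sym (*-assoc _ _ _))

  zpow-swap : ∀ q qi z → zpow R qi q z ≡ zpow R q qi (ℤ.- z)
  zpow-swap q qi (+ ℕ.zero)  = ≡.refl
  zpow-swap q qi (+ ℕ.suc n) = ≡.refl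
  zpow-swap q qi ℤ.-[1+ n ]  = ≡.refl

  sumR-factorˡ : ∀ {A : Set} (f h : A → Carrier) k (xs : List A) → (∀ a → f a ≈ k * h a) →
    sumR R (List.map f xs) ≈ k * sumR R (List.map h xs)
  sumR-factorˡ f h k List.[]        f≈k*h = sym (zeroʳ k)
  sumR-factorˡ f h k (a List.∷ xs) f≈k*h =
    trans (+-cong (f≈k*h a) (sumR-factorˡ f h k xs f≈k*h)) (sym (distribˡ k _ _))

  module _ (q qi : Carrier) (q*qi≈1 : q * qi ≈ 1#) where
    open SetoidReasoning setoid

    zpow-⊖ : ∀ m n → zpow R q qi (m ℤ.⊖ n) ≈ pow R q m * pow R qi n
    zpow-⊖ ℕ.zero    ℕ.zero    = sym (*-identityˡ _)
    zpow-⊖ (ℕ.suc m) ℕ.zero    = sym (*-identityʳ _)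
    zpow-⊖ ℕ.zero    (ℕ.suc n) = sym (*-identityˡ _)
    zpow-⊖ (ℕ.suc m) (ℕ.suc n) = begin
      zpow R q qi (ℕ.suc m ℤ.⊖ ℕ.suc n)       ≡⟨ ≡.cong (zpow R q qi) (ℤ.[1+m]⊖[1+n]≡m⊖n m n) ⟩
      zpow R q qi (m ℤ.⊖ n)                   ≈⟨ zpow-⊖ m n ⟩
      pow R q m * pow R qi n                  ≈⟨ *-identityˡ _ ⟨
      1# * (pow R q m * pow R qi n)           ≈⟨ *-congʳ q*qi≈1 ⟨
      (q * qi) * (pow R q m * pow R qi n)     ≈⟨ interchange q qi _ _ ⟩
      (q * pow R q m) * (qi * pow R qi n)     ∎

    zpow-+ : ∀ z w → zpow R q qi (z ℤ.+ w) ≈ zpow R q qi z * zpow R q qi w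
    zpow-+ (+ m)       (+ n)       = pow-+ q m n
    zpow-+ (+ m)       ℤ.-[1+ n ] = zpow-⊖ m (ℕ.suc n)
    zpow-+ ℤ.-[1+ m ] (+ n)       = trans (zpow-⊖ n (ℕ.suc m)) (*-comm _ _)
    zpow-+ ℤ.-[1+ m ] ℤ.-[1+ n ] = begin
      pow R qi (ℕ.suc (ℕ.suc (m ℕ.+ n)))      ≡⟨ ≡.cong (pow R qi ∘ ℕ.suc) (ℕ.+-suc m n) ⟨
      pow R qi (ℕ.suc m ℕ.+ ℕ.suc n)          ≈⟨ pow-+ qi (ℕ.suc m) (ℕ.suc n) ⟩
      pow R qi (ℕ.suc m) * pow R qi (ℕ.suc n) ∎

lemma3p6 : {c ℓ : Level} (R : CommutativeRing c ℓ) →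
    let open CommutativeRing R in
    (q qi : Carrier) → q * qi ≈ 1# →
    (u v : ℕ) → u ℕ.≤ v → (x : Vec ℤ v) →
    g R qi q u v (map (λ xk → + 2 ℤ.- xk) x)
      ≈ zpow R q qi (ℤ.- (+ (u ℕ.* (2 ℕ.* v ℕ.+ u ℕ.∸ 1)))) * g R q qi u v x
lemma3p6 R q qi q*qi≈1 u v _ x =
  sumR-factorˡ R _ _ (zpow R q qi N) (List.filterᵇ (λ ε → weight ε ℕ.≡ᵇ u) (allBoolVecs v))
    summand-reflect
  where
  open CommutativeRing R
  open SetoidReasoning setoid
  x′ = map (λ xk → + 2 ℤ.- xk) x
  N = ℤ.- (+ (u ℕ.* (2 ℕ.* v ℕ.+ u ℕ.∸ 1)))
  summand-reflect : ∀ ε → zpow R qi q (gExp u v x′ ε)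
                            ≈ zpow R q qi N * zpow R q qi (gExp u v x ε)
  summand-reflect ε = begin
    zpow R qi q (gExp u v x′ ε)               ≡⟨ zpow-swap R q qi (gExp u v x′ ε) ⟩
    zpow R q qi (ℤ.- gExp u v x′ ε)           ≡⟨ ≡.cong (zpow R q qi) (gExp-reflect u v x ε) ⟩
    zpow R q qi (N ℤ.+ gExp u v x ε)          ≈⟨ zpow-+ R q qi q*qi≈1 N (gExp u v x ε) ⟩
    zpow R q qi N * zpow R q qi (gExp u v x ε) ∎
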